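{- Let $a\ge 5$ and let $G$ be an $a\times a$ pseudogrid. Let $s,v,w,t$ be vertices of $G$ such that $s$ lies in column $1$ of $G$, $v,w\in\mathrm{int}_1(G)$, and $t$ lies in column $a$ of $G$. Then $G$ contains a path $P$ with endpoints $s$ and $t$ that contains $v$ and $w$.
   Context: The $a\times a$ grid $G_a$ has vertex set $\{1,\dots,a\}^2$, with $(i_1,j_1),(i_2,j_2)$ adjacent iff $|i_1-i_2|+|j_1-j_2|=1$; for a graph $H$, $\mathrm{VE}(H):=V(H)\cup E(H)$. An $a\times a$ pseudogrid is any graph obtained from $G_a$ as follows. Each edge $vw$ is replaced by a path $\overline{P}_{vw}$ with endpoints $v,w$ (subdivided zero or more times); $P_{vw}$ is the (possibly empty) path of its internal vertices. Each vertex $v=(i,j)$ of degree $4$ is replaced by a nonempty path $P_v$: if $P_v$ has one vertex it takes the place of $v$; otherwise $P_v$ has endpoints $p,q$ and each of the four edges formerly joining $v$ to its neighbour on $\overline{P}_{vu}$ is redirected to $p$ or $q$ according to one of: (Q1) edges toward $(i-1,j),(i,j-1)$ to $p$, toward $(i+1,j),(i,j+1)$ to $q$; (Q2) edges toward $(i,j+1),(i-1,j)$ to $p$, toward $(i,j-1),(i+1,j)$ to $q$; (Q3) edges toward $(i-1,j),(i+1,j)$ to $p$, toward $(i,j-1),(i,j+1)$ to $q$. For $v$ of degree less than $4$, $P_v$ is the one-vertex path on $v$. $\{V(P_\mu):\mu\in\mathrm{VE}(G_a)\}$ is the grid-partition of $V(G)$. Column $i$ of $G$ is the path in $G$ corresponding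 to the grid column $(i,1),\dots,(i,a)$: it consists of all vertices of $P_{(i,j)(i,j+1)}$ for $1\le j<a$ together with, for each $j$, the subpath of $P_{(i,j)}$ between the endpoint joined toward $(i,j-1)$ and the endpoint joined toward $(i,j+1)$ (all of $P_{(i,j)}$ in cases (Q1),(Q2), only $q$ in case (Q3), and the single vertex if $P_{(i,j)}$ is trivial). Rows are defined analogously. $\mathrm{int}_1(G_a)$ is the induced subgraph of $G_a$ on $\{2,\dots,a-1\}^2$, and $\mathrm{int}_1(G):=\bigcup_{\mu\in\mathrm{VE}(\mathrm{int}_1(G_a))}V(P_\mu)$. -}

module Defs where

open import Data.Nat using (ℕ; zero; suc; _≤_; _<_; _⊔_; _⊓_; _≤ᵇ_; _<ᵇ_)
open import Data.Bool using (Bool; true; false; if_then_else_; _∧_)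
open import Data.Product using (_×_)
open import Data.Sum using (_⊎_)
open import Data.Empty using (⊥)
open import Data.List using (List; head; last)
open import Data.Maybe using (just)
open import Data.List.Relation.Unary.All using (All)
open import Data.List.Relation.Unary.Linked using (Linked)
open import Data.List.Relation.Unary.Unique.Propositional using (Unique)
open import Relation.Binary.PropositionalEquality using (_≡_)

-- Grid coordinates are 1-indexed natural numbers (i , j) with 1 ≤ i , j ≤ a,
-- exactly as in the paper.

-- The three ways (Q1),(Q2),(Q3) of attaching the four edges to the
-- endpoints p , q of a nontrivial path P_v.
data QType : Set where
  Q1 Q2 Q3 : QType

-- Directions from v = (i , j):  W = (i-1 , j), E = (i+1 , j),
-- S = (i , j-1), N = (i , j+1).
data Dir : Set where
  W E S N : Dir

record Pseudogrid (a : ℕ) : Set where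
  field
    -- number of subdivision (internal) vertices on the edge (i,j)(i+1,j)
    hsub : ℕ → ℕ → ℕ
    -- number of subdivision (internal) vertices on the edge (i,j)(i,j+1)
    vsub : ℕ → ℕ → ℕ
    -- for a degree-4 vertex (i,j): P_(i,j) has (plen i j + 1) vertices
    plen : ℕ → ℕ → ℕ
    -- for a degree-4 vertex (i,j) with nontrivial P_(i,j): its type
    ptype : ℕ → ℕ → QType

module _ {a : ℕ} (D : Pseudogrid a) where
  open Pseudogrid D

  deg4 : ℕ → ℕ → Bool
  deg4 i j = (2 ≤ᵇ i) ∧ (2 ≤ᵇ j) ∧ (i <ᵇ a) ∧ (j <ᵇ a)

  -- P_(i,j) has vertices 0 , … , L i j  (p = 0 , q = L i j);
  -- trivial for vertices of degree < 4.
  L : ℕ → ℕ → ℕ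
  L i j = if deg4 i j then plen i j else 0

  -- index on P_(i,j) of the endpoint to which the edge toward direction d
  -- is attached
  port : Dir → ℕ → ℕ → ℕ
  port d i j = pick (ptype i j) d
    where
    p q : ℕ
    p = 0
    q = L i j
    pick : QType → Dir → ℕ
    pick Q1 W = p
    pick Q1 S = p
    pick Q1 E = q
    pick Q1 N = q
    pick Q2 N = p
    pick Q2 W = p
    pick Q2 S = q
    pick Q2 E = q
    pick Q3 W = p
    pick Q3 E = p
    pick Q3 S = q
    pick Q3 N = q

-- Vertices of a pseudogrid (names; validity is a separate predicate).
data Vtx : Set where
  gv : ℕ → ℕ → ℕ → Vtx   -- gv i j k : k-th vertex of P_(i,j)
  he : ℕ → ℕ → ℕ → Vtx   -- he i j k : k-th internal vertex of P_(i,j)(i+1,j), from (i,j)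
  ve : ℕ → ℕ → ℕ → Vtx   -- ve i j k : k-th internal vertex of P_(i,j)(i,j+1), from (i,j)

module _ {a : ℕ} (D : Pseudogrid a) where
  open Pseudogrid D

  Valid : Vtx → Set
  Valid (gv i j k) = 1 ≤ i × i ≤ a × 1 ≤ j × j ≤ a × k ≤ L D i j
  Valid (he i j k) = 1 ≤ i × suc i ≤ a × 1 ≤ j × j ≤ a × k < hsub i j
  Valid (ve i j k) = 1 ≤ i × i ≤ a × 1 ≤ j × suc j ≤ a × k < vsub i j

  -- edges of G (one orientation; adjacency is the symmetric closure)
  data Adj₀ : Vtx → Vtx → Set where
    inP : ∀ {i j k} → 1 ≤ i → i ≤ a → 1 ≤ j → j ≤ a → suc k ≤ L D i j →
          Adj₀ (gv i j k) (gv i j (suc k))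
    inH : ∀ {i j k} → 1 ≤ i → suc i ≤ a → 1 ≤ j → j ≤ a → suc k < hsub i j →
          Adj₀ (he i j k) (he i j (suc k))
    inV : ∀ {i j k} → 1 ≤ i → i ≤ a → 1 ≤ j → suc j ≤ a → suc k < vsub i j →
          Adj₀ (ve i j k) (ve i j (suc k))
    h0 : ∀ {i j} → 1 ≤ i → suc i ≤ a → 1 ≤ j → j ≤ a → hsub i j ≡ 0 →
         Adj₀ (gv i j (port D E i j)) (gv (suc i) j (port D W (suc i) j))
    hL : ∀ {i j} → 1 ≤ i → suc i ≤ a → 1 ≤ j → j ≤ a → 0 < hsub i j →
         Adj₀ (gv i j (port D E i j)) (he i j 0)
    hR : ∀ {i j k} → 1 ≤ i → suc i ≤ a → 1 ≤ j → j ≤ a → suc k ≡ hsub i j →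
         Adj₀ (he i j k) (gv (suc i) j (port D W (suc i) j))
    v0 : ∀ {i j} → 1 ≤ i → i ≤ a → 1 ≤ j → suc j ≤ a → vsub i j ≡ 0 →
         Adj₀ (gv i j (port D N i j)) (gv i (suc j) (port D S i (suc j)))
    vL : ∀ {i j} → 1 ≤ i → i ≤ a → 1 ≤ j → suc j ≤ a → 0 < vsub i j →
         Adj₀ (gv i j (port D N i j)) (ve i j 0)
    vR : ∀ {i j k} → 1 ≤ i → i ≤ a → 1 ≤ j → suc j ≤ a → suc k ≡ vsub i j →
         Adj₀ (ve i j k) (gv i (suc j) (port D S i (suc j)))

  Adj : Vtx → Vtx → Set
  Adj x y = Adj₀ x y ⊎ Adj₀ y x

  InColumn : ℕ → Vtx → Set
  InColumn c (gv i j k) =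
    i ≡ c × 1 ≤ i × i ≤ a × 1 ≤ j × j ≤ a ×
    (port D S i j ⊓ port D N i j) ≤ k × k ≤ (port D S i j ⊔ port D N i j)
  InColumn c (he i j k) = ⊥
  InColumn c (ve i j k) = i ≡ c × Valid (ve i j k)

  InInt1 : Vtx → Set
  InInt1 (gv i j k) = 2 ≤ i × suc i ≤ a × 2 ≤ j × suc j ≤ a × k ≤ L D i j
  InInt1 (he i j k) = 2 ≤ i × suc (suc i) ≤ a × 2 ≤ j × suc j ≤ a × k < hsub i j
  InInt1 (ve i j k) = 2 ≤ i × suc i ≤ a × 2 ≤ j × suc (suc j) ≤ a × k < vsub i j

  record Path (s t : Vtx) : Set where
    field
      verts    : List Vtx
      start    : head verts ≡ just s
      end      : last verts ≡ just t
      valid    : All Valid verts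
      adjacent : Linked Adj verts
      distinct : Unique verts

{-# OPTIONS --safe #-}
-- The path snakes through the grid from left to right: it starts inside column 1 at s, and in
-- each column c it moves vertically from the row e at which it entered to a row x, from where it
-- crosses the horizontal edge of row x into column c + 1; in column a it ends at t.  Such a path
-- is simple because its pieces occupy disjoint ranges of columns and rows.  Only the (at most
-- two) columns containing v and w need care.  A vertical move covers the edges it climbs, and it
-- covers a whole path P_(c,j) exactly when it enters and leaves P_(c,j) at its two different
-- ends; by the attachment rules (Q1)-(Q3) this can always be arranged by choosing e and x a row
-- below or above (c,j).  A vertex inside the horizontal edge of row x is covered by leaving the
-- column at row x.  The one configuration that no such path handles, v and w inside two different
-- horizontal edges between the same two columns, is covered by a zigzag through those columns.
module Submission where

open import Defs
open import Data.Nat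
  using ( ℕ; zero; suc; _+_; _∸_; _⊔_; _≤ᵇ_; _<ᵇ_; _≤?_; _<?_; _≤_; _<_; z≤n; s≤s; s≤s⁻¹; z<s
        ; _≤′_; ≤′-refl; ≤′-step)
open import Data.Nat.Properties
open import Data.Product using (Σ; Σ-syntax; _×_; _,_; proj₁; proj₂)
open import Data.Sum using (_⊎_; inj₁; inj₂)
open import Data.Empty using (⊥; ⊥-elim)
open import Data.Unit using (⊤)
open import Data.Bool using (Bool; true; false)
open import Data.Bool.Properties using (∧-zeroʳ)
open import Data.Maybe using (just)
open import Data.Maybe.Relation.Binary.Connected using (Connected; just)
open import Data.List using (List; []; _∷_; _++_; _∷ʳ_; head; last; reverse; applyUpTo)
open import Data.List.Properties using (unfold-reverse; reverse-involutive)
open import Data.List.Relation.Unary.All as All using (All; []; _∷_)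
import Data.List.Relation.Unary.All.Properties as All
open import Data.List.Relation.Unary.AllPairs using ([]; _∷_)
open import Data.List.Relation.Unary.Any using (here)
import Data.List.Relation.Unary.Any.Properties as Any
open import Data.List.Relation.Unary.Linked using (Linked; []; [-]; _∷_)
import Data.List.Relation.Unary.Linked.Properties as Linked
open import Data.List.Relation.Unary.Unique.Propositional using (Unique)
import Data.List.Relation.Unary.Unique.Propositional.Properties as Unique
open import Data.List.Membership.Propositional using (_∈_)
open import Data.List.Relation.Binary.Disjoint.Propositional using (Disjoint)
open import Data.List.Membership.Propositional.Properties
  using (∈-++⁺ˡ; ∈-++⁺ʳ; ∈-++⁻; ∈-applyUpTo⁺; ∈-applyUpTo⁻)
open import Relation.Binary.PropositionalEquality using (_≡_; _≢_; refl; sym; trans; cong; subst; subst₂)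
open import Relation.Nullary using (¬_; yes; no)
open import Relation.Binary.Definitions using (tri<; tri≈; tri>)

≥2⇒≥1 : ∀ {n} → 2 ≤ n → 1 ≤ n
≥2⇒≥1 = ≤-trans (s≤s z≤n)

n<ᵇn : ∀ n → (n <ᵇ n) ≡ false
n<ᵇn zero    = refl
n<ᵇn (suc n) = n<ᵇn n

module _ {ℓ} {A : Set ℓ} where

  last-++-∷ : (xs : List A) {y : A} (ys : List A) → last (xs ++ y ∷ ys) ≡ last (y ∷ ys)
  last-++-∷ []           ys = refl
  last-++-∷ (x ∷ [])     ys = refl
  last-++-∷ (x ∷ x′ ∷ xs) ys = last-++-∷ (x′ ∷ xs) ys

  head-++ : (xs ys : List A) {x : A} → head xs ≡ just x → head (xs ++ ys) ≡ just x
  head-++ (x ∷ xs) ys eq = eq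

  last-∷ʳ : (xs : List A) (x : A) → last (xs ∷ʳ x) ≡ just x
  last-∷ʳ xs x = last-++-∷ xs []

  last-applyUpTo : (f : ℕ → A) (n : ℕ) → last (applyUpTo f (suc n)) ≡ just (f n)
  last-applyUpTo f zero          = refl
  last-applyUpTo f (suc zero)    = refl
  last-applyUpTo f (suc (suc n)) = last-applyUpTo (λ i → f (suc i)) (suc n)

  last-reverse : (xs : List A) → last (reverse xs) ≡ head xs
  last-reverse []       = refl
  last-reverse (x ∷ xs) rewrite unfold-reverse x xs = last-∷ʳ (reverse xs) x

  head-reverse : (xs : List A) → head (reverse xs) ≡ last xs
  head-reverse xs = trans (sym (last-reverse (reverse xs))) (cong last (reverse-involutive xs))

  All-reverse : ∀ {p} {P : A → Set p} {xs} → All P xs → All P (reverse xs)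
  All-reverse ps = All.tabulate (λ x∈ → All.lookup ps (Any.reverse⁻ x∈))

  Unique-reverse : ∀ {xs : List A} → Unique xs → Unique (reverse xs)
  Unique-reverse []                        = []
  Unique-reverse {x ∷ xs} (x∉xs ∷ distinct) rewrite unfold-reverse x xs =
    Unique.++⁺ (Unique-reverse distinct) ([] ∷ [])
      λ { (x∈ , here refl) → All.lookup x∉xs (Any.reverse⁻ x∈) refl }

  Linked-reverse : ∀ {r} {R : A → A → Set r} → (∀ {x y} → R x y → R y x) →
                   ∀ {xs} → Linked R xs → Linked R (reverse xs)
  Linked-reverse R-sym []  = []
  Linked-reverse R-sym [-] = [-]
  Linked-reverse {R = R} R-sym {x ∷ y ∷ xs} (r ∷ rs) rewrite unfold-reverse x (y ∷ xs) =
    Linked.++⁺ (Linked-reverse R-sym rs)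
      (subst (λ m → Connected R m (just x)) (sym (last-reverse (y ∷ xs))) (just (R-sym r))) [-]

module Grid {a : ℕ} (G : Pseudogrid a) where
  open Pseudogrid G
  open Path

  Adj-sym : ∀ {x y} → Adj G x y → Adj G y x
  Adj-sym (inj₁ e) = inj₂ e
  Adj-sym (inj₂ e) = inj₁ e

  Disjoint-by : ∀ {P Q : Vtx → Set} {xs ys} → All P xs → All Q ys →
                (∀ {v} → P v → Q v → ⊥) → Disjoint xs ys
  Disjoint-by ps qs P⇒¬Q (v∈xs , v∈ys) = P⇒¬Q (All.lookup ps v∈xs) (All.lookup qs v∈ys)

  ∉-by : ∀ {P : Vtx → Set} {xs v} → All P xs → ¬ P v → ¬ v ∈ xs
  ∉-by ps ¬Pv v∈xs = ¬Pv (All.lookup ps v∈xs)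

  singletonPath : ∀ {x} → Valid G x → Path G x x
  singletonPath x-valid = record
    { verts = _ ∷ [] ; start = refl ; end = refl
    ; valid = x-valid ∷ [] ; adjacent = [-] ; distinct = [] ∷ [] }

  reversePath : ∀ {x y} → Path G x y → Path G y x
  reversePath p = record
    { verts    = reverse (verts p)
    ; start    = trans (head-reverse (verts p)) (end p)
    ; end      = trans (last-reverse (verts p)) (start p)
    ; valid    = All-reverse (valid p)
    ; adjacent = Linked-reverse Adj-sym (adjacent p)
    ; distinct = Unique-reverse (distinct p) }

  concatPath : ∀ {x y y′ z} (p : Path G x y) (q : Path G y′ z) → Adj G y y′ →
               Disjoint (verts p) (verts q) → Path G x z
  concatPath {z = z} p q y~y′ disjoint = record
    { verts    = verts p ++ verts q
    ; start    = head-++ (verts p) (verts q) (start p)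
    ; end      = end-++
    ; valid    = All.++⁺ (valid p) (valid q)
    ; adjacent = Linked.++⁺ (adjacent p)
                   (subst₂ (Connected (Adj G)) (sym (end p)) (sym (start q)) (just y~y′))
                   (adjacent q)
    ; distinct = Unique.++⁺ (distinct p) (distinct q) disjoint }
    where
    end-++ : last (verts p ++ verts q) ≡ just z
    end-++ with verts q | end q
    ... | w ∷ ws | last≡z = trans (last-++-∷ (verts p) ws) last≡z

  castPath : ∀ {x y x′ y′} → Path G x y → x ≡ x′ → y ≡ y′ → Path G x′ y′
  castPath p x≡x′ y≡y′ = record
    { verts = verts p ; start = trans (start p) (cong just x≡x′) ; end = trans (end p) (cong just y≡y′)
    ; valid = valid p ; adjacent = adjacent p ; distinct = distinct p }

  straightPath : (f : ℕ → Vtx) → (∀ {m n} → f m ≡ f n → m ≡ n) → (n : ℕ) →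
                 (∀ {k} → k ≤ n → Valid G (f k)) →
                 (∀ {k} → k < n → Adj G (f k) (f (suc k))) → Path G (f 0) (f n)
  straightPath f f-injective n f-valid f-adjacent = record
    { verts    = applyUpTo f (suc n)
    ; start    = refl
    ; end      = last-applyUpTo f n
    ; valid    = All.applyUpTo⁺₁ f (suc n) (λ k<1+n → f-valid (s≤s⁻¹ k<1+n))
    ; adjacent = Linked.applyUpTo⁺₁ f (suc n) (λ k+1<1+n → f-adjacent (s≤s⁻¹ k+1<1+n))
    ; distinct = Unique.applyUpTo⁺₁ f (suc n) (λ i<j _ fi≡fj → <⇒≢ i<j (f-injective fi≡fj)) }

  InGrid : ℕ → ℕ → Set
  InGrid i j = 1 ≤ i × i ≤ a × 1 ≤ j × j ≤ a

  -- false is the end p (index 0) of P_(i,j), true the end q (index L i j).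
  attachedEnd : QType → Dir → Bool
  attachedEnd Q1 W = false
  attachedEnd Q1 S = false
  attachedEnd Q1 E = true
  attachedEnd Q1 N = true
  attachedEnd Q2 N = false
  attachedEnd Q2 W = false
  attachedEnd Q2 S = true
  attachedEnd Q2 E = true
  attachedEnd Q3 W = false
  attachedEnd Q3 E = false
  attachedEnd Q3 S = true
  attachedEnd Q3 N = true

  endIndex : ℕ → ℕ → Bool → ℕ
  endIndex i j false = 0
  endIndex i j true  = L G i j

  port≡endIndex : ∀ d i j → port G d i j ≡ endIndex i j (attachedEnd (ptype i j) d)
  port≡endIndex d i j with ptype i j
  port≡endIndex W i j | Q1 = refl
  port≡endIndex E i j | Q1 = refl
  port≡endIndex S i j | Q1 = refl
  port≡endIndex N i j | Q1 = refl
  port≡endIndex W i j | Q2 = refl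
  port≡endIndex E i j | Q2 = refl
  port≡endIndex S i j | Q2 = refl
  port≡endIndex N i j | Q2 = refl
  port≡endIndex W i j | Q3 = refl
  port≡endIndex E i j | Q3 = refl
  port≡endIndex S i j | Q3 = refl
  port≡endIndex N i j | Q3 = refl

  -- Entering P_(i,j) from d and leaving toward d′ traverses all of it.
  Opposite : QType → Dir → Dir → Set
  Opposite Q d d′ = attachedEnd Q d ≢ attachedEnd Q d′

  gv-injective : ∀ {i j m n} → gv i j m ≡ gv i j n → m ≡ n
  gv-injective refl = refl

  he-injective : ∀ {i j m n} → he i j m ≡ he i j n → m ≡ n
  he-injective refl = refl

  ve-injective : ∀ {i j m n} → ve i j m ≡ ve i j n → m ≡ n
  ve-injective refl = refl

  module _ {i j : ℕ} (ij-in : InGrid i j) where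
    private
      i≥1 = proj₁ ij-in
      i≤a = proj₁ (proj₂ ij-in)
      j≥1 = proj₁ (proj₂ (proj₂ ij-in))
      j≤a = proj₂ (proj₂ (proj₂ ij-in))

    wholeBranch : Path G (gv i j 0) (gv i j (L G i j))
    wholeBranch = straightPath (gv i j) gv-injective (L G i j)
      (λ k≤L → i≥1 , i≤a , j≥1 , j≤a , k≤L) (λ k<L → inj₁ (inP i≥1 i≤a j≥1 j≤a k<L))

    branchSpan : (b b′ : Bool) → Path G (gv i j (endIndex i j b)) (gv i j (endIndex i j b′))
    branchSpan false false = singletonPath (i≥1 , i≤a , j≥1 , j≤a , z≤n)
    branchSpan true  true  = singletonPath (i≥1 , i≤a , j≥1 , j≤a , ≤-refl)
    branchSpan false true  = wholeBranch
    branchSpan true  false = reversePath wholeBranch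

    branchSpan-covers : ∀ b b′ → b ≢ b′ →
                        ∀ {k} → k ≤ L G i j → gv i j k ∈ verts (branchSpan b b′)
    branchSpan-covers false false b≢b′ _   = ⊥-elim (b≢b′ refl)
    branchSpan-covers true  true  b≢b′ _   = ⊥-elim (b≢b′ refl)
    branchSpan-covers false true  _    k≤L = ∈-applyUpTo⁺ (gv i j) (s≤s k≤L)
    branchSpan-covers true  false _    k≤L = Any.reverse⁺ (∈-applyUpTo⁺ (gv i j) (s≤s k≤L))

    branchSpan-All : ∀ {P : Vtx → Set} b b′ → (∀ k → P (gv i j k)) → All P (verts (branchSpan b b′))
    branchSpan-All false false P-gv = P-gv 0 ∷ []
    branchSpan-All true  true  P-gv = P-gv _ ∷ []
    branchSpan-All false true  P-gv = All.applyUpTo⁺₂ (gv i j) (suc (L G i j)) P-gv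
    branchSpan-All true  false P-gv = All-reverse (All.applyUpTo⁺₂ (gv i j) (suc (L G i j)) P-gv)

    branchPath : (d d′ : Dir) → Path G (gv i j (port G d i j)) (gv i j (port G d′ i j))
    branchPath d d′ = castPath (branchSpan (attachedEnd (ptype i j) d) (attachedEnd (ptype i j) d′))
      (cong (gv i j) (sym (port≡endIndex d i j))) (cong (gv i j) (sym (port≡endIndex d′ i j)))

    branchPath-covers : ∀ d d′ → Opposite (ptype i j) d d′ →
                        ∀ {k} → k ≤ L G i j → gv i j k ∈ verts (branchPath d d′)
    branchPath-covers d d′ = branchSpan-covers (attachedEnd (ptype i j) d) (attachedEnd (ptype i j) d′)

    branchPath-All : ∀ {P : Vtx → Set} d d′ → (∀ k → P (gv i j k)) → All P (verts (branchPath d d′))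
    branchPath-All d d′ = branchSpan-All (attachedEnd (ptype i j) d) (attachedEnd (ptype i j) d′)

  record SubdividedEdge (y y′ : Vtx) : Set where
    field
      interior           : ℕ → Vtx
      length             : ℕ
      interior-injective : ∀ {k l} → interior k ≡ interior l → k ≡ l
      interior-valid     : ∀ {k} → k < length → Valid G (interior k)
      direct             : length ≡ 0 → Adj G y y′
      first              : 0 < length → Adj G y (interior 0)
      step               : ∀ {k} → suc k < length → Adj G (interior k) (interior (suc k))
      final              : ∀ {k} → suc k ≡ length → Adj G (interior k) y′

  horizontalEdge : ∀ {i j} → 1 ≤ i → suc i ≤ a → 1 ≤ j → j ≤ a →
                   SubdividedEdge (gv i j (port G E i j)) (gv (suc i) j (port G W (suc i) j))
  horizontalEdge {i} {j} i≥1 i<a j≥1 j≤a = record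
    { interior = he i j ; length = hsub i j ; interior-injective = he-injective
    ; interior-valid = λ k< → i≥1 , i<a , j≥1 , j≤a , k<
    ; direct = λ eq → inj₁ (h0 i≥1 i<a j≥1 j≤a eq) ; first = λ 0< → inj₁ (hL i≥1 i<a j≥1 j≤a 0<)
    ; step = λ k< → inj₁ (inH i≥1 i<a j≥1 j≤a k<)
    ; final = λ eq → inj₁ (hR i≥1 i<a j≥1 j≤a eq) }

  verticalEdge : ∀ {i j} → 1 ≤ i → i ≤ a → 1 ≤ j → suc j ≤ a →
                 SubdividedEdge (gv i j (port G N i j)) (gv i (suc j) (port G S i (suc j)))
  verticalEdge {i} {j} i≥1 i≤a j≥1 j<a = record
    { interior = ve i j ; length = vsub i j ; interior-injective = ve-injective
    ; interior-valid = λ k< → i≥1 , i≤a , j≥1 , j<a , k<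
    ; direct = λ eq → inj₁ (v0 i≥1 i≤a j≥1 j<a eq) ; first = λ 0< → inj₁ (vL i≥1 i≤a j≥1 j<a 0<)
    ; step = λ k< → inj₁ (inV i≥1 i≤a j≥1 j<a k<)
    ; final = λ eq → inj₁ (vR i≥1 i≤a j≥1 j<a eq) }

  record Joined {x y y′ z} (f : ℕ → Vtx) (m : ℕ) (A : Path G x y) (B : Path G y′ z) : Set₁ where
    field
      path      : Path G x z
      ⊇left     : ∀ {v} → v ∈ verts A → v ∈ verts path
      ⊇interior : ∀ {k} → k < m → f k ∈ verts path
      ⊇right    : ∀ {v} → v ∈ verts B → v ∈ verts path
      All-path  : ∀ {P : Vtx → Set} → All P (verts A) → (∀ k → P (f k)) → All P (verts B) →
                  All P (verts path)

  module _ {y y′} (e : SubdividedEdge y y′) where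
    open SubdividedEdge e

    interiorPath : ∀ {k l} → k ≤ l → l < length → Path G (interior k) (interior l)
    interiorPath {k} {l} k≤l l<length =
      castPath (straightPath (λ i → interior (k + i)) (λ eq → +-cancelˡ-≡ k _ _ (interior-injective eq))
                  (l ∸ k) (λ i≤ → interior-valid (below i≤)) consecutive)
               (cong interior (+-identityʳ k)) (cong interior (m+[n∸m]≡n k≤l))
      where
      below : ∀ {i} → i ≤ l ∸ k → k + i < length
      below i≤ = ≤-<-trans (≤-trans (+-monoʳ-≤ k i≤) (≤-reflexive (m+[n∸m]≡n k≤l))) l<length
      consecutive : ∀ {i} → i < l ∸ k → Adj G (interior (k + i)) (interior (k + suc i))
      consecutive {i} i< = subst (λ n → Adj G (interior (k + i)) (interior n)) (sym (+-suc k i))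
                          (step (subst (_< length) (+-suc k i) (below i<)))

    interiorPath-∉ : ∀ {k l} (k≤l : k ≤ l) (l<length : l < length) {xs} →
                     (∀ i → ¬ interior i ∈ xs) →
                     ∀ {v} → v ∈ verts (interiorPath k≤l l<length) → ¬ v ∈ xs
    interiorPath-∉ {k} _ _ interior∉ v∈ with ∈-applyUpTo⁻ (λ i → interior (k + i)) v∈
    ... | i , _ , refl = interior∉ (k + i)

    interiorPath-All : ∀ {P : Vtx → Set} {k l} (k≤l : k ≤ l) (l<length : l < length) →
                       (∀ i → P (interior i)) → All P (verts (interiorPath k≤l l<length))
    interiorPath-All {k = k} {l} _ _ P-interior = All.applyUpTo⁺₂ _ (suc (l ∸ k)) (λ i → P-interior (k + i))

    enterEdge : ∀ {x k} (A : Path G x y) → k < length → (∀ i → ¬ interior i ∈ verts A) →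
                Path G x (interior k)
    enterEdge A k<length interior∉A =
      concatPath A (interiorPath z≤n k<length) (first (≤-<-trans z≤n k<length))
      (λ (v∈A , v∈I) → interiorPath-∉ z≤n k<length interior∉A v∈I v∈A)

    enterEdge-All : ∀ {P : Vtx → Set} {x k} (A : Path G x y) (k<length : k < length) interior∉A →
                    All P (verts A) → (∀ i → P (interior i)) →
                    All P (verts (enterEdge A k<length interior∉A))
    enterEdge-All A k<length _ PA P-interior = All.++⁺ PA (interiorPath-All z≤n k<length P-interior)

    private
      last-index : ∀ {k} → k < length → suc (length ∸ 1) ≡ length
      last-index k<length = m+[n∸m]≡n (≤-trans (s≤s z≤n) k<length)

      ≤-last : ∀ {k} → k < length → k ≤ length ∸ 1
      ≤-last k<length = ∸-monoˡ-≤ 1 k<length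

      last<length : ∀ {k} → k < length → length ∸ 1 < length
      last<length k<length = ≤-reflexive (last-index k<length)

    enterEdgeBackwards : ∀ {x k} (A : Path G x y′) → k < length → (∀ i → ¬ interior i ∈ verts A) →
                         Path G x (interior k)
    enterEdgeBackwards A k<length interior∉A =
      concatPath A (reversePath (interiorPath (≤-last k<length) (last<length k<length)))
        (Adj-sym (final (last-index k<length)))
        (λ (v∈A , v∈I) →
          interiorPath-∉ (≤-last k<length) (last<length k<length) interior∉A (Any.reverse⁻ v∈I) v∈A)

    enterEdgeBackwards-All : ∀ {P : Vtx → Set} {x k} (A : Path G x y′) (k<length : k < length) interior∉A →
                             All P (verts A) → (∀ i → P (interior i)) →
                             All P (verts (enterEdgeBackwards A k<length interior∉A))
    enterEdgeBackwards-All A k<length interior∉A PA P-interior =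
      All.++⁺ PA (All-reverse (interiorPath-All (≤-last k<length) (last<length k<length) P-interior))

    joinAlong : ∀ {x z} (A : Path G x y) (B : Path G y′ z) → Disjoint (verts A) (verts B) →
                (∀ k → ¬ interior k ∈ verts A) → (∀ k → ¬ interior k ∈ verts B) →
                Joined interior length A B
    joinAlong A B A∩B interior∉A interior∉B with length in length≡
    ... | zero = record
      { path = concatPath A B (direct length≡) A∩B
      ; ⊇left = ∈-++⁺ˡ ; ⊇interior = λ () ; ⊇right = ∈-++⁺ʳ (verts A)
      ; All-path = λ PA _ PB → All.++⁺ PA PB }
    ... | suc m = record
      { path = concatPath A (concatPath I B (final (sym length≡)) I∩B)
                 (first (subst (0 <_) (sym length≡) z<s)) A∩IB
      ; ⊇left = ∈-++⁺ˡ
      ; ⊇interior = λ k<1+m → ∈-++⁺ʳ (verts A) (∈-++⁺ˡ (∈-applyUpTo⁺ interior k<1+m))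
      ; ⊇right = λ v∈B → ∈-++⁺ʳ (verts A) (∈-++⁺ʳ (verts I) v∈B)
      ; All-path = λ PA Pf PB → All.++⁺ PA (All.++⁺ (All.applyUpTo⁺₂ interior (suc m) Pf) PB) }
      where
      m<length = subst (m <_) (sym length≡) (n<1+n m)
      I : Path G (interior 0) (interior m)
      I = interiorPath z≤n m<length
      I∩B : Disjoint (verts I) (verts B)
      I∩B (v∈I , v∈B) = interiorPath-∉ z≤n m<length interior∉B v∈I v∈B
      A∩IB : Disjoint (verts A) (verts I ++ verts B)
      A∩IB (v∈A , v∈IB) with ∈-++⁻ (verts I) v∈IB
      ... | inj₁ v∈I = interiorPath-∉ z≤n m<length interior∉A v∈I v∈A
      ... | inj₂ v∈B = A∩B (v∈A , v∈B)

    joinAlongBackwards : ∀ {x z} (A : Path G x y′) (B : Path G y z) → Disjoint (verts A) (verts B) →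
                         (∀ k → ¬ interior k ∈ verts A) → (∀ k → ¬ interior k ∈ verts B) →
                         Joined interior length A B
    joinAlongBackwards A B A∩B interior∉A interior∉B = record
      { path = reversePath path
      ; ⊇left = λ v∈A → Any.reverse⁺ (⊇right (Any.reverse⁺ v∈A))
      ; ⊇interior = λ k< → Any.reverse⁺ (⊇interior k<)
      ; ⊇right = λ v∈B → Any.reverse⁺ (⊇left (Any.reverse⁺ v∈B))
      ; All-path = λ PA Pf PB → All-reverse (All-path (All-reverse PB) Pf (All-reverse PA)) }
      where
      open Joined (joinAlong (reversePath B) (reversePath A)
        (λ (v∈B , v∈A) → A∩B (Any.reverse⁻ v∈A , Any.reverse⁻ v∈B))
        (λ k v∈B → interior∉B k (Any.reverse⁻ v∈B)) (λ k v∈A → interior∉A k (Any.reverse⁻ v∈A)))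

  -- Doubled coordinates: the internal vertices of an edge sit strictly between the even
  -- coordinates of its ends, so pieces of a path in disjoint coordinate ranges are disjoint.
  col₂ : Vtx → ℕ
  col₂ (gv i j k) = i + i
  col₂ (ve i j k) = i + i
  col₂ (he i j k) = suc (i + i)

  row₂ : Vtx → ℕ
  row₂ (gv i j k) = j + j
  row₂ (ve i j k) = suc (j + j)
  row₂ (he i j k) = j + j

  double-suc : ∀ n → suc n + suc n ≡ suc (suc (n + n))
  double-suc n = cong suc (+-suc n n)

  double-mono-≤ : ∀ {m n} → m ≤ n → m + m ≤ n + n
  double-mono-≤ m≤n = +-mono-≤ m≤n m≤n

  double-mono-< : ∀ {m n} → m < n → suc (suc (m + m)) ≤ n + n
  double-mono-< {m} {n} m<n = subst (_≤ n + n) (double-suc m) (double-mono-≤ m<n)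

  Strip : ℕ → ℕ → ℕ → Vtx → Set
  Strip c r x v = col₂ v ≡ c + c × r + r ≤ row₂ v × row₂ v ≤ x + x

  record VerticalRun (c r x : ℕ) (din dout : Dir) : Set where
    field
      path          : Path G (gv c r (port G din c r)) (gv c x (port G dout c x))
      inStrip       : All (Strip c r x) (verts path)
      covers-edge   : ∀ {j k} → r ≤ j → j < x → k < vsub c j → ve c j k ∈ verts path
      covers-single : r ≡ x → Opposite (ptype c r) din dout →
                      ∀ {k} → k ≤ L G c r → gv c r k ∈ verts path
      covers-first  : r < x → Opposite (ptype c r) din N →
                      ∀ {k} → k ≤ L G c r → gv c r k ∈ verts path
      covers-middle : ∀ {j} → r < j → j < x → Opposite (ptype c j) S N →
                      ∀ {k} → k ≤ L G c j → gv c j k ∈ verts path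
      covers-last   : r < x → Opposite (ptype c x) S dout →
                      ∀ {k} → k ≤ L G c x → gv c x k ∈ verts path

  singleRowRun : ∀ {c r} din dout → InGrid c r → VerticalRun c r r din dout
  singleRowRun din dout cr-in = record
    { path          = branchPath cr-in din dout
    ; inStrip       = branchPath-All cr-in din dout (λ _ → refl , ≤-refl , ≤-refl)
    ; covers-edge   = λ r≤j j<r → ⊥-elim (<⇒≱ j<r r≤j)
    ; covers-single = λ _ → branchPath-covers cr-in din dout
    ; covers-first  = λ r<r → ⊥-elim (<-irrefl refl r<r)
    ; covers-middle = λ r<j j<r → ⊥-elim (<-asym r<j j<r)
    ; covers-last   = λ r<r → ⊥-elim (<-irrefl refl r<r) }

  extendRunUp : ∀ {c r x din} dout → 1 ≤ c → c ≤ a → 1 ≤ r → r ≤ x → suc x ≤ a →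
                VerticalRun c r x din N → VerticalRun c r (suc x) din dout
  extendRunUp {c} {r} {x} {din} dout c≥1 c≤a r≥1 r≤x x<a lower = record
    { path          = path
    ; inStrip       = All-path (All.map (λ {v} → widen {v}) lower.inStrip) (λ _ → refl , edge-in-strip)
                        (branchPath-All top-in S dout (λ _ → refl , top-in-strip , ≤-refl))
    ; covers-edge   = covers-edge
    ; covers-single = λ r≡1+x → ⊥-elim (<-irrefl r≡1+x (s≤s r≤x))
    ; covers-first  = covers-first
    ; covers-middle = covers-middle
    ; covers-last   = λ _ opp k≤L → ⊇right (branchPath-covers top-in S dout opp k≤L) }
    where
    module lower = VerticalRun lower
    top-in = c≥1 , c≤a , s≤s z≤n , x<a
    top-row : All (λ v → row₂ v ≡ suc x + suc x) (verts (branchPath top-in S dout))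
    top-row = branchPath-All top-in S dout (λ _ → refl)
    2x<2x+2 : x + x < suc x + suc x
    2x<2x+2 = ≤-trans (n≤1+n _) (≤-reflexive (sym (double-suc x)))
    open Joined (joinAlong (verticalEdge c≥1 c≤a (≤-trans r≥1 r≤x) x<a) lower.path
      (branchPath top-in S dout)
      (Disjoint-by lower.inStrip top-row
        λ (_ , _ , row≤) row≡ → <⇒≱ (subst (x + x <_) (sym row≡) 2x<2x+2) row≤)
      (λ k → ∉-by lower.inStrip λ (_ , _ , row≤) → 1+n≰n row≤)
      (λ k → ∉-by top-row λ row≡ → 1+n≢n (sym (trans row≡ (double-suc x)))))
    widen : ∀ {v} → Strip c r x v → Strip c r (suc x) v
    widen (col≡ , r≤row , row≤) = col≡ , r≤row , ≤-trans row≤ (double-mono-≤ (n≤1+n x))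
    edge-in-strip : r + r ≤ suc (x + x) × suc (x + x) ≤ suc x + suc x
    edge-in-strip = ≤-trans (double-mono-≤ r≤x) (n≤1+n _) , 2x<2x+2
    top-in-strip : r + r ≤ suc x + suc x
    top-in-strip = double-mono-≤ (m≤n⇒m≤1+n r≤x)
    covers-edge : ∀ {j k} → r ≤ j → j < suc x → k < vsub c j → ve c j k ∈ verts path
    covers-edge r≤j j<1+x with m≤n⇒m<n∨m≡n (s≤s⁻¹ j<1+x)
    ... | inj₁ j<x  = λ k< → ⊇left (lower.covers-edge r≤j j<x k<)
    ... | inj₂ refl = ⊇interior
    covers-first : r < suc x → Opposite (ptype c r) din N → ∀ {k} → k ≤ L G c r → gv c r k ∈ verts path
    covers-first _ opp k≤L with m≤n⇒m<n∨m≡n r≤x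
    ... | inj₁ r<x = ⊇left (lower.covers-first r<x opp k≤L)
    ... | inj₂ r≡x = ⊇left (lower.covers-single r≡x opp k≤L)
    covers-middle : ∀ {j} → r < j → j < suc x → Opposite (ptype c j) S N →
                    ∀ {k} → k ≤ L G c j → gv c j k ∈ verts path
    covers-middle r<j j<1+x opp k≤L with m≤n⇒m<n∨m≡n (s≤s⁻¹ j<1+x)
    ... | inj₁ j<x  = ⊇left (lower.covers-middle r<j j<x opp k≤L)
    ... | inj₂ refl = ⊇left (lower.covers-last r<j opp k≤L)

  verticalRun : ∀ {c r x} din dout → 1 ≤ c → c ≤ a → 1 ≤ r → x ≤ a → r ≤′ x →
                VerticalRun c r x din dout
  verticalRun din dout c≥1 c≤a r≥1 r≤a ≤′-refl = singleRowRun din dout (c≥1 , c≤a , r≥1 , r≤a)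
  verticalRun din dout c≥1 c≤a r≥1 x<a (≤′-step r≤′x) =
    extendRunUp dout c≥1 c≤a r≥1 (≤′⇒≤ r≤′x) x<a
      (verticalRun din N c≥1 c≤a r≥1 (<⇒≤ x<a) r≤′x)

  record ColumnPath (c e x : ℕ) : Set where
    field
      path     : Path G (gv c e (port G W c e)) (gv c x (port G E c x))
      inColumn : All (λ v → col₂ v ≡ c + c) (verts path)

  upColumn : ∀ {c e x} → VerticalRun c e x W E → ColumnPath c e x
  upColumn R = record { path = VerticalRun.path R ; inColumn = All.map proj₁ (VerticalRun.inStrip R) }

  downColumn : ∀ {c e x} → VerticalRun c x e E W → ColumnPath c e x
  downColumn R = record
    { path = reversePath (VerticalRun.path R) ; inColumn = All-reverse (All.map proj₁ (VerticalRun.inStrip R)) }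

  flatColumn : ∀ {c x} → InGrid c x → ColumnPath c x x
  flatColumn (c≥1 , c≤a , x≥1 , x≤a) = upColumn (verticalRun W E c≥1 c≤a x≥1 x≤a ≤′-refl)

  anyColumn : ∀ {c e x} → 1 ≤ c → c ≤ a → 1 ≤ e → e ≤ a → 1 ≤ x → x ≤ a → ColumnPath c e x
  anyColumn c≥1 c≤a e≥1 e≤a x≥1 x≤a with ≤-total _ _
  ... | inj₁ e≤x = upColumn (verticalRun W E c≥1 c≤a e≥1 x≤a (≤⇒≤′ e≤x))
  ... | inj₂ x≤e = downColumn (verticalRun E W c≥1 c≤a x≥1 e≤a (≤⇒≤′ x≤e))

  TrivialColumn : ℕ → Set
  TrivialColumn c = ∀ j → L G c j ≡ 0

  trivial-port : ∀ {c} → TrivialColumn c → ∀ d j → port G d c j ≡ 0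
  trivial-port {c} trivial d j = trans (port≡endIndex d c j) (endIndex≡0 (attachedEnd (ptype c j) d))
    where
    endIndex≡0 : ∀ b → endIndex c j b ≡ 0
    endIndex≡0 false = refl
    endIndex≡0 true  = trivial j

  first-column-trivial : TrivialColumn 1
  first-column-trivial j = refl

  last-column-trivial : TrivialColumn a
  last-column-trivial j rewrite n<ᵇn a | ∧-zeroʳ (2 ≤ᵇ j) | ∧-zeroʳ (2 ≤ᵇ a) = refl

  -- In columns 1 and a every P_(i,j) is a single vertex, so a vertex t of such a column is
  -- reached from any row within the column.
  boundaryPath : ∀ {c x} → TrivialColumn c → 1 ≤ x → x ≤ a → (t : Vtx) → InColumn G c t →
                 Σ[ p ∈ Path G (gv c x (port G W c x)) t ] All (λ v → col₂ v ≡ c + c) (verts p)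
  boundaryPath trivial x≥1 x≤a (gv c j k) (refl , c≥1 , c≤a , j≥1 , j≤a , _ , k≤) =
    castPath (ColumnPath.path col) refl (cong (gv c j) (trans (trivial-port trivial E j) (sym k≡0))) ,
    ColumnPath.inColumn col
    where
    col = anyColumn c≥1 c≤a x≥1 x≤a j≥1 j≤a
    k≡0 : k ≡ 0
    k≡0 = n≤0⇒n≡0
      (subst₂ (λ m n → k ≤ m ⊔ n) (trivial-port trivial S j) (trivial-port trivial N j) k≤)
  boundaryPath {x = x} trivial x≥1 x≤a (ve c j k) (refl , c≥1 , c≤a , j≥1 , j<a , k<) with x ≤? j
  ... | yes x≤j = enterEdge edge R.path k< edge∉R ,
                  enterEdge-All edge R.path k< edge∉R (All.map proj₁ R.inStrip) (λ _ → refl)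
    where
    edge = verticalEdge c≥1 c≤a j≥1 j<a
    module R = VerticalRun (verticalRun W N c≥1 c≤a x≥1 (≤-trans (n≤1+n j) j<a) (≤⇒≤′ x≤j))
    edge∉R : ∀ i → ¬ ve c j i ∈ verts R.path
    edge∉R _ = ∉-by R.inStrip λ (_ , _ , row≤) → 1+n≰n row≤
  ... | no x≰j = enterEdgeBackwards edge R⁻¹ k< edge∉R ,
                 enterEdgeBackwards-All edge R⁻¹ k< edge∉R (All.map proj₁ R⁻¹-inStrip) (λ _ → refl)
    where
    edge = verticalEdge c≥1 c≤a j≥1 j<a
    module R = VerticalRun (verticalRun S W c≥1 c≤a (s≤s z≤n) x≤a (≤⇒≤′ (≰⇒> x≰j)))
    R⁻¹ = reversePath R.path
    R⁻¹-inStrip = All-reverse R.inStrip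
    edge∉R : ∀ i → ¬ ve c j i ∈ verts R⁻¹
    edge∉R _ = ∉-by R⁻¹-inStrip
      λ (_ , row≥ , _) → 1+n≰n (subst (_≤ suc (j + j)) (double-suc j) row≥)

  WithinColumns : ℕ → ℕ → Vtx → Set
  WithinColumns c d v = c + c ≤ col₂ v × col₂ v ≤ d + d

  inColumn⇒within : ∀ {c xs} → All (λ v → col₂ v ≡ c + c) xs → All (WithinColumns c c) xs
  inColumn⇒within = All.map (λ col≡ → ≤-reflexive (sym col≡) , ≤-reflexive col≡)

  record ZigzagPath (c j j′ : ℕ) : Set where
    field
      path    : Path G (gv c j (port G W c j)) (gv (suc c) (suc j′) (port G E (suc c) (suc j′)))
      within  : All (WithinColumns c (suc c)) (verts path)
      ⊇lower  : ∀ {k} → k < hsub c j → he c j k ∈ verts path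
      ⊇upper  : ∀ {k} → k < hsub c j′ → he c j′ k ∈ verts path

  -- Cross P_(c,j) and the edge of row j eastward, climb column c+1 to row j′, cross the edge
  -- of row j′ back west, climb column c to row j′+1 and cross the edge of row j′+1 eastward.
  module Zigzag {c j j′} (c≥1 : 1 ≤ c) (c+1<a : suc c < a) (j≥1 : 1 ≤ j) (j<j′ : j < j′) (j′<a : j′ < a)
    where
    private
      c<a = <-trans (n<1+n c) c+1<a
      j′≥1 = ≤-trans j≥1 (<⇒≤ j<j′)
      j≤a = ≤-trans (<⇒≤ j<j′) (<⇒≤ j′<a)

      2c<2c+1 : c + c < suc (c + c)
      2c<2c+1 = n<1+n _
      2c+1<2c+2 : suc (c + c) < suc c + suc c
      2c+1<2c+2 = ≤-reflexive (sym (double-suc c))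
      2c<2c+2 : c + c < suc c + suc c
      2c<2c+2 = <-trans 2c<2c+1 2c+1<2c+2
      2j<2j′ : j + j < j′ + j′
      2j<2j′ = ≤-trans (n≤1+n _) (double-mono-< j<j′)
      2j′<2j′+2 : j′ + j′ < suc j′ + suc j′
      2j′<2j′+2 = ≤-trans (n≤1+n _) (≤-reflexive (sym (double-suc j′)))

      left-within : ∀ {xs} → All (λ v → col₂ v ≡ c + c) xs → All (WithinColumns c (suc c)) xs
      left-within = All.map λ col≡ →
        ≤-reflexive (sym col≡) , ≤-trans (≤-reflexive col≡) (<⇒≤ 2c<2c+2)
      right-within : ∀ {xs} → All (λ v → col₂ v ≡ suc c + suc c) xs → All (WithinColumns c (suc c)) xs
      right-within = All.map λ col≡ →
        ≤-trans (<⇒≤ 2c<2c+2) (≤-reflexive (sym col≡)) , ≤-reflexive col≡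
      edge-within : ∀ {i k} → WithinColumns c (suc c) (he c i k)
      edge-within = <⇒≤ 2c<2c+1 , <⇒≤ 2c+1<2c+2

      A = branchPath (c≥1 , <⇒≤ c<a , j≥1 , j≤a) W E
      A-cells : All (λ v → col₂ v ≡ c + c × row₂ v ≡ j + j) (verts A)
      A-cells = branchPath-All (c≥1 , <⇒≤ c<a , j≥1 , j≤a) W E (λ _ → refl , refl)
      module B = VerticalRun
        (verticalRun W W (s≤s z≤n) (<⇒≤ c+1<a) j≥1 (<⇒≤ j′<a) (≤⇒≤′ (<⇒≤ j<j′)))
      module C = VerticalRun (verticalRun E E c≥1 (<⇒≤ c<a) j′≥1 j′<a (≤′-step ≤′-refl))
      D = branchPath (s≤s z≤n , <⇒≤ c+1<a , s≤s z≤n , j′<a) W E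
      D-cells : All (λ v → col₂ v ≡ suc c + suc c × row₂ v ≡ suc j′ + suc j′) (verts D)
      D-cells = branchPath-All (s≤s z≤n , <⇒≤ c+1<a , s≤s z≤n , j′<a) W E (λ _ → refl , refl)

      A-col = All.map proj₁ A-cells
      B-col = All.map proj₁ B.inStrip
      C-col = All.map proj₁ C.inStrip
      D-col = All.map proj₁ D-cells

      left∩right : ∀ {v} → col₂ v ≡ c + c → col₂ v ≡ suc c + suc c → ⊥
      left∩right col≡ col≡′ = <-irrefl (trans (sym col≡) col≡′) 2c<2c+2
      edge∉left : ∀ {i k} → col₂ (he c i k) ≢ c + c
      edge∉left col≡ = <-irrefl (sym col≡) 2c<2c+1
      edge∉right : ∀ {i k} → col₂ (he c i k) ≢ suc c + suc c
      edge∉right col≡ = <-irrefl col≡ 2c+1<2c+2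

      module AB = Joined (joinAlong (horizontalEdge c≥1 c<a j≥1 j≤a) A B.path
        (Disjoint-by A-col B-col λ {v} → left∩right {v})
        (λ i → ∉-by A-col (edge∉left {j} {i})) (λ i → ∉-by B-col (edge∉right {j} {i})))
      module CD = Joined (joinAlong (horizontalEdge c≥1 c<a (s≤s z≤n) j′<a) C.path D
        (Disjoint-by C-col D-col λ {v} → left∩right {v})
        (λ i → ∉-by C-col (edge∉left {suc j′} {i})) (λ i → ∉-by D-col (edge∉right {suc j′} {i})))

      -- The two halves meet only in row j′, in different columns.
      Below Above : Vtx → Set
      Below v = row₂ v < j′ + j′ ⊎ (row₂ v ≡ j′ + j′ × col₂ v ≡ suc c + suc c)
      Above v = j′ + j′ < row₂ v ⊎ (row₂ v ≡ j′ + j′ × col₂ v ≡ c + c)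

      Below∩Above : ∀ {v} → Below v → Above v → ⊥
      Below∩Above (inj₁ row<)       (inj₁ row>)       = <-asym row< row>
      Below∩Above (inj₁ row<)       (inj₂ (row≡ , _)) = <-irrefl row≡ row<
      Below∩Above (inj₂ (row≡ , _)) (inj₁ row>)       = <-irrefl (sym row≡) row>
      Below∩Above (inj₂ (_ , col≡)) (inj₂ (_ , col≡′)) = <-irrefl (trans (sym col≡′) col≡) 2c<2c+2

      edge∉Below : ∀ {k} → ¬ Below (he c j′ k)
      edge∉Below (inj₁ row<)       = <-irrefl refl row<
      edge∉Below (inj₂ (_ , col≡)) = <-irrefl col≡ 2c+1<2c+2

      edge∉Above : ∀ {k} → ¬ Above (he c j′ k)
      edge∉Above (inj₁ row>)       = <-irrefl refl row>
      edge∉Above (inj₂ (_ , col≡)) = <-irrefl (sym col≡) 2c<2c+1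

      B-below : ∀ {v} → Strip (suc c) j j′ v → Below v
      B-below (col≡ , _ , row≤) with m≤n⇒m<n∨m≡n row≤
      ... | inj₁ row< = inj₁ row<
      ... | inj₂ row≡ = inj₂ (row≡ , col≡)

      C-above : ∀ {v} → Strip c j′ (suc j′) v → Above v
      C-above (col≡ , row≥ , _) with m≤n⇒m<n∨m≡n row≥
      ... | inj₁ row> = inj₁ row>
      ... | inj₂ row≡ = inj₂ (sym row≡ , col≡)

      AB-below : All Below (verts AB.path)
      AB-below = AB.All-path
        (All.map (λ {v} (_ , row≡) → inj₁ (subst (_< j′ + j′) (sym row≡) 2j<2j′)) A-cells)
        (λ _ → inj₁ 2j<2j′)
        (All.map (λ {v} → B-below {v}) B.inStrip)

      CD-above : All Above (verts CD.path)
      CD-above = CD.All-path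
        (All.map (λ {v} → C-above {v}) C.inStrip)
        (λ _ → inj₁ 2j′<2j′+2)
        (All.map (λ {v} (_ , row≡) → inj₁ (subst (j′ + j′ <_) (sym row≡) 2j′<2j′+2)) D-cells)

      module ABCD = Joined (joinAlongBackwards (horizontalEdge c≥1 c<a j′≥1 (<⇒≤ j′<a)) AB.path CD.path
        (Disjoint-by AB-below CD-above λ {v} → Below∩Above {v})
        (λ k → ∉-by AB-below (edge∉Below {k})) (λ k → ∉-by CD-above (edge∉Above {k})))

    zigzagPath : ZigzagPath c j j′
    zigzagPath = record
      { path   = ABCD.path
      ; within = ABCD.All-path
          (AB.All-path (left-within A-col) (λ i → edge-within {j} {i}) (right-within B-col))
          (λ i → edge-within {j′} {i})
          (CD.All-path (left-within C-col) (λ i → edge-within {suc j′} {i}) (right-within D-col))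
      ; ⊇lower = λ k< → ABCD.⊇left (AB.⊇interior k<)
      ; ⊇upper = ABCD.⊇interior }

  module Routes (s : Vtx) where

    record Prefix (c x : ℕ) : Set where
      field
        path     : Path G s (gv c x (port G E c x))
        confined : All (λ v → col₂ v ≤ c + c) (verts path)
        c≥1      : 1 ≤ c
        x-in     : 1 ≤ x × x ≤ a

    record Extension {c x c′ z} (pr : Prefix c x) (B : Path G (gv c′ x (port G W c′ x)) z) (d : ℕ) :
                     Set₁ where
      field
        path     : Path G s z
        confined : All (λ v → col₂ v ≤ d + d) (verts path)
        ⊇prefix  : ∀ {v} → v ∈ verts (Prefix.path pr) → v ∈ verts path
        ⊇B       : ∀ {v} → v ∈ verts B → v ∈ verts path
        ⊇edge    : ∀ {k} → k < hsub c x → he c x k ∈ verts path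

    extendAdjacent : ∀ {c x z d} (pr : Prefix c x) → suc c ≤ a → c < d →
                     (B : Path G (gv (suc c) x (port G W (suc c) x)) z) →
                     All (WithinColumns (suc c) d) (verts B) → Extension pr B d
    extendAdjacent {c} {x} {d = d} pr c<a c<d B B-within = record
      { path = path
      ; confined = All-path (All.map (λ col≤ → ≤-trans col≤ (double-mono-≤ (<⇒≤ c<d))) pr.confined)
                   (λ _ → c+c<d+d) (All.map proj₂ B-within)
      ; ⊇prefix = ⊇left ; ⊇B = ⊇right ; ⊇edge = ⊇interior }
      where
      module pr = Prefix pr
      c+c<B : ∀ {v} → WithinColumns (suc c) d v → suc (c + c) < col₂ v
      c+c<B {v} (2c+2≤ , _) = subst (_≤ col₂ v) (double-suc c) 2c+2≤
      c+c<d+d : suc (c + c) ≤ d + d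
      c+c<d+d = ≤-trans (n≤1+n _) (double-mono-< c<d)
      open Joined (joinAlong (horizontalEdge pr.c≥1 c<a (proj₁ pr.x-in) (proj₂ pr.x-in)) pr.path B
        (Disjoint-by pr.confined B-within
          λ {v} col≤ within → <⇒≱ (≤-<-trans col≤ (<-trans (n<1+n _) (c+c<B {v} within))) ≤-refl)
        (λ k → ∉-by pr.confined 1+n≰n)
        (λ k → ∉-by B-within (λ within → <-irrefl refl (c+c<B {he c x k} within))))

    toPrefix : ∀ {c x c′ d x′} {pr : Prefix c x}
                 {B : Path G (gv c′ x (port G W c′ x)) (gv d x′ (port G E d x′))} →
               1 ≤ d → 1 ≤ x′ → x′ ≤ a → Extension pr B d → Prefix d x′
    toPrefix d≥1 x′≥1 x′≤a ext = record
      { path = Extension.path ext ; confined = Extension.confined ext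
      ; c≥1 = d≥1 ; x-in = x′≥1 , x′≤a }

    record Advance {c x} (pr : Prefix c x) (c′ : ℕ) : Set₁ where
      field
        prefix  : Prefix c′ x
        ⊇prefix : ∀ {v} → v ∈ verts (Prefix.path pr) → v ∈ verts (Prefix.path prefix)
        ⊇edge   : c < c′ → ∀ {k} → k < hsub c x → he c x k ∈ verts (Prefix.path prefix)

    afterAdvance : ∀ {c x c′ z d} {pr : Prefix c x} {B : Path G (gv (suc c′) x (port G W (suc c′) x)) z} →
                   c ≤ c′ → (A : Advance pr c′) → Extension (Advance.prefix A) B d → Extension pr B d
    afterAdvance {c} {x} c≤c′ A ext = record
      { path = ext.path ; confined = ext.confined ; ⊇prefix = λ v∈ → ext.⊇prefix (A.⊇prefix v∈)
      ; ⊇B = ext.⊇B ; ⊇edge = ⊇edge }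
      where
      module A = Advance A
      module ext = Extension ext
      ⊇edge : ∀ {k} → k < hsub c x → he c x k ∈ verts ext.path
      ⊇edge with m≤n⇒m<n∨m≡n c≤c′
      ... | inj₁ c<c′ = λ k< → ext.⊇prefix (A.⊇edge c<c′ k<)
      ... | inj₂ refl = ext.⊇edge

    advance : ∀ {c x c′} (pr : Prefix c x) → c ≤′ c′ → c′ ≤ a → Advance pr c′
    advance pr ≤′-refl _ = record
      { prefix = pr ; ⊇prefix = λ v∈ → v∈ ; ⊇edge = λ c<c → ⊥-elim (<-irrefl refl c<c) }
    advance {c} {x} pr (≤′-step {c′} c≤′c′) c′<a = record
      { prefix = toPrefix (s≤s z≤n) (proj₁ x-in) (proj₂ x-in) ext
      ; ⊇prefix = Extension.⊇prefix ext
      ; ⊇edge = λ _ → Extension.⊇edge ext }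
      where
      open Prefix pr using (x-in)
      A = advance pr c≤′c′ (≤-trans (n≤1+n _) c′<a)
      flat = flatColumn (s≤s z≤n , c′<a , x-in)
      ext = afterAdvance (≤′⇒≤ c≤′c′) A
            (extendAdjacent (Advance.prefix A) c′<a (n<1+n c′) (ColumnPath.path flat)
              (inColumn⇒within {suc c′} (ColumnPath.inColumn flat)))

    extend : ∀ {c x c′ z d} (pr : Prefix c x) → c < c′ → c′ ≤ a → c′ ≤ d →
             (B : Path G (gv c′ x (port G W c′ x)) z) → All (WithinColumns c′ d) (verts B) →
             Extension pr B d
    extend {c′ = suc c′} pr c<c′ c′<a c′<d B B-within =
      afterAdvance c≤c′ A (extendAdjacent (Advance.prefix A) c′<a c′<d B B-within)
      where
      c≤c′ = s≤s⁻¹ c<c′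
      A = advance pr (≤⇒≤′ c≤c′) (≤-trans (n≤1+n _) c′<a)

    throughColumn : ∀ {c x c′ x′} (pr : Prefix c x) → c < c′ → c′ ≤ a → (col : ColumnPath c′ x x′) →
                    Extension pr (ColumnPath.path col) c′
    throughColumn {c′ = c′} pr c<c′ c′≤a col =
      extend pr c<c′ c′≤a ≤-refl (ColumnPath.path col) (inColumn⇒within {c′} (ColumnPath.inColumn col))

    startPrefix : InColumn G 1 s → ∀ {e} → 1 ≤ e → e ≤ a → Prefix 1 e
    startPrefix s-in {e} e≥1 e≤a = record
      { path = castPath (reversePath (proj₁ fromStart)) refl
                 (cong (gv 1 e) (trans (trivial-port first-column-trivial W e)
                                       (sym (trivial-port first-column-trivial E e))))
      ; confined = All-reverse (All.map ≤-reflexive (proj₂ fromStart))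
      ; c≥1 = ≤-refl ; x-in = e≥1 , e≤a }
      where fromStart = boundaryPath first-column-trivial e≥1 e≤a s s-in

    record Completion {c x} (pr : Prefix c x) (t : Vtx) : Set where
      field
        path    : Path G s t
        ⊇prefix : ∀ {v} → v ∈ verts (Prefix.path pr) → v ∈ verts path
        ⊇edge   : ∀ {k} → k < hsub c x → he c x k ∈ verts path

    complete : ∀ {c x} (pr : Prefix c x) → c < a → (t : Vtx) → InColumn G a t → Completion pr t
    complete pr c<a t t-in = record { path = path ; ⊇prefix = ⊇prefix ; ⊇edge = ⊇edge }
      where
      open Prefix pr using (x-in)
      toEnd = boundaryPath last-column-trivial (proj₁ x-in) (proj₂ x-in) t t-in
      open Extension (extend pr c<a ≤-refl ≤-refl (proj₁ toEnd) (inColumn⇒within {a} (proj₂ toEnd)))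

  column : Vtx → ℕ
  column (gv i _ _) = i
  column (he i _ _) = i
  column (ve i _ _) = i

  lowRow highRow : Vtx → ℕ
  lowRow (gv _ j _) = j
  lowRow (he _ j _) = j
  lowRow (ve _ j _) = j
  highRow (gv _ j _) = j
  highRow (he _ j _) = j
  highRow (ve _ j _) = suc j

  -- A vertex on an edge between two columns is covered by the extension that follows a column
  -- path, provided the column path leaves at the row of that edge.
  Covers : Vtx → ℕ → List Vtx → Set
  Covers (gv i j _) x vs = ∀ {k} → k ≤ L G i j → gv i j k ∈ vs
  Covers (ve i j _) x vs = ∀ {k} → k < vsub i j → ve i j k ∈ vs
  Covers (he i j _) x vs = x ≡ j

  ColumnVertex : Vtx → Set
  ColumnVertex (he _ _ _) = ⊥
  ColumnVertex _          = ⊤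

  UpCovers DownCovers : ℕ → Vtx → ℕ → ℕ → Set
  UpCovers c τ e x = (R : VerticalRun c e x W E) → Covers τ x (verts (VerticalRun.path R))
  DownCovers c τ e x = (R : VerticalRun c x e E W) → Covers τ x (verts (reversePath (VerticalRun.path R)))

  opposite-at : ∀ {c j Q d d′} → ptype c j ≡ Q → attachedEnd Q d ≢ attachedEnd Q d′ →
                Opposite (ptype c j) d d′
  opposite-at refl opp = opp

  -- An entry row (upFrom, downFrom) or exit row (upTo, downTo) such that every upward, resp.
  -- downward, column path through it that passes τ covers τ.  The row is that of τ itself unless
  -- the type of P_τ forbids the required turn, in which case it is the next row.
  upFrom : ∀ τ → ColumnVertex τ → InInt1 G τ →
           Σ[ e ∈ ℕ ] (1 ≤ e × e ≤ lowRow τ × (∀ {x} → lowRow τ < x → UpCovers (column τ) τ e x))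
  upFrom (gv c (suc j) k) _ (_ , _ , s≤s j≥1 , _) with ptype c (suc j) in type
  ... | Q1 = suc j , s≤s z≤n , ≤-refl , λ j<x R → VerticalRun.covers-first R j<x (opposite-at type λ ())
  ... | Q3 = suc j , s≤s z≤n , ≤-refl , λ j<x R → VerticalRun.covers-first R j<x (opposite-at type λ ())
  ... | Q2 = j , j≥1 , n≤1+n j , λ j<x R → VerticalRun.covers-middle R (n<1+n j) j<x (opposite-at type λ ())
  upFrom (ve c j k) _ (_ , _ , j≥2 , _) =
    j , ≥2⇒≥1 j≥2 , ≤-refl , λ j<x R → VerticalRun.covers-edge R ≤-refl j<x

  upTo : ∀ τ → ColumnVertex τ → InInt1 G τ →
         Σ[ x ∈ ℕ ] (highRow τ ≤ x × x ≤ a × (∀ {e} → e < highRow τ → UpCovers (column τ) τ e x))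
  upTo (gv c j k) _ (_ , _ , _ , j<a , _) with ptype c j in type
  ... | Q1 = j , ≤-refl , <⇒≤ j<a , λ e<j R → VerticalRun.covers-last R e<j (opposite-at type λ ())
  ... | Q3 = j , ≤-refl , <⇒≤ j<a , λ e<j R → VerticalRun.covers-last R e<j (opposite-at type λ ())
  ... | Q2 = suc j , n≤1+n j , j<a , λ e<j R → VerticalRun.covers-middle R e<j (n<1+n j) (opposite-at type λ ())
  upTo (ve c j k) _ (_ , _ , _ , j+1<a , _) =
    suc j , ≤-refl , <⇒≤ j+1<a , λ e≤j R → VerticalRun.covers-edge R (s≤s⁻¹ e≤j) (n<1+n j)

  downFrom : ∀ τ → ColumnVertex τ → InInt1 G τ →
             Σ[ e ∈ ℕ ] (highRow τ ≤ e × e ≤ a ×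
                         (∀ {x} → x < highRow τ → DownCovers (column τ) τ e x))
  downFrom (gv c j k) _ (_ , _ , _ , j<a , _) with ptype c j in type
  ... | Q2 = j , ≤-refl , <⇒≤ j<a , λ x<j R k≤ →
               Any.reverse⁺ (VerticalRun.covers-last R x<j (opposite-at type λ ()) k≤)
  ... | Q3 = j , ≤-refl , <⇒≤ j<a , λ x<j R k≤ →
               Any.reverse⁺ (VerticalRun.covers-last R x<j (opposite-at type λ ()) k≤)
  ... | Q1 = suc j , n≤1+n j , j<a , λ x<j R k≤ →
               Any.reverse⁺ (VerticalRun.covers-middle R x<j (n<1+n j) (opposite-at type λ ()) k≤)
  downFrom (ve c j k) _ (_ , _ , _ , j+1<a , _) =
    suc j , ≤-refl , <⇒≤ j+1<a ,
    λ x≤j R k< → Any.reverse⁺ (VerticalRun.covers-edge R (s≤s⁻¹ x≤j) (n<1+n j) k<)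

  downTo : ∀ τ → ColumnVertex τ → InInt1 G τ →
           Σ[ x ∈ ℕ ] (1 ≤ x × x ≤ lowRow τ ×
                       (∀ {e} → lowRow τ < e → DownCovers (column τ) τ e x))
  downTo (gv c (suc j) k) _ (_ , _ , s≤s j≥1 , _) with ptype c (suc j) in type
  ... | Q2 = suc j , s≤s z≤n , ≤-refl , λ j<e R k≤ →
               Any.reverse⁺ (VerticalRun.covers-first R j<e (opposite-at type λ ()) k≤)
  ... | Q3 = suc j , s≤s z≤n , ≤-refl , λ j<e R k≤ →
               Any.reverse⁺ (VerticalRun.covers-first R j<e (opposite-at type λ ()) k≤)
  ... | Q1 = j , j≥1 , n≤1+n j , λ j<e R k≤ →
               Any.reverse⁺ (VerticalRun.covers-middle R (n<1+n j) j<e (opposite-at type λ ()) k≤)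
  downTo (ve c j k) _ (_ , _ , j≥2 , _) =
    j , ≥2⇒≥1 j≥2 , ≤-refl , λ j<e R k< → Any.reverse⁺ (VerticalRun.covers-edge R ≤-refl j<e k<)

  record CoveringColumn (c e : ℕ) (T : ℕ → List Vtx → Set) : Set where
    field
      exit    : ℕ
      exit≥1  : 1 ≤ exit
      exit≤a  : exit ≤ a
      columnPath : ColumnPath c e exit
      covers  : T exit (verts (ColumnPath.path columnPath))

  InteriorColumn : ℕ → Set
  InteriorColumn c = 2 ≤ c × c < a

  coverUp : ∀ {c e x} {T : ℕ → List Vtx → Set} → InteriorColumn c → 1 ≤ e → e ≤ x → x ≤ a →
            ((R : VerticalRun c e x W E) → T x (verts (VerticalRun.path R))) → CoveringColumn c e T
  coverUp (c≥2 , c<a) e≥1 e≤x x≤a covers = record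
    { exit = _ ; exit≥1 = ≤-trans e≥1 e≤x ; exit≤a = x≤a ; columnPath = upColumn R ; covers = covers R }
    where R = verticalRun W E (≥2⇒≥1 c≥2) (<⇒≤ c<a) e≥1 x≤a (≤⇒≤′ e≤x)

  coverDown : ∀ {c e x} {T : ℕ → List Vtx → Set} → InteriorColumn c → 1 ≤ x → x ≤ e → e ≤ a →
              ((R : VerticalRun c x e E W) → T x (verts (reversePath (VerticalRun.path R)))) →
              CoveringColumn c e T
  coverDown (c≥2 , c<a) x≥1 x≤e e≤a covers = record
    { exit = _ ; exit≥1 = x≥1 ; exit≤a = ≤-trans x≤e e≤a ; columnPath = downColumn R ; covers = covers R }
    where R = verticalRun E W (≥2⇒≥1 c≥2) (<⇒≤ c<a) x≥1 e≤a (≤⇒≤′ x≤e)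

  column-bounds : ∀ τ → InInt1 G τ → InteriorColumn (column τ)
  column-bounds (gv c j k) (c≥2 , c<a , _)   = c≥2 , c<a
  column-bounds (he c j k) (c≥2 , c+1<a , _) = c≥2 , <-trans (n<1+n c) c+1<a
  column-bounds (ve c j k) (c≥2 , c<a , _)   = c≥2 , c<a

  -- Entering P_(c,j) from the west: Q3 joins west to north, the other types west to east.
  enterBranch : ∀ {c j k} → InInt1 G (gv c j k) → CoveringColumn c j (Covers (gv c j k))
  enterBranch {c} {j} (c≥2 , c<a , j≥2 , j<a , _) with ptype c j in type
  ... | Q1 = coverUp (c≥2 , c<a) (≥2⇒≥1 j≥2) ≤-refl (<⇒≤ j<a)
               λ R → VerticalRun.covers-single R refl (opposite-at type λ ())
  ... | Q2 = coverUp (c≥2 , c<a) (≥2⇒≥1 j≥2) ≤-refl (<⇒≤ j<a)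
               λ R → VerticalRun.covers-single R refl (opposite-at type λ ())
  ... | Q3 = coverUp (c≥2 , c<a) (≥2⇒≥1 j≥2) (n≤1+n j) j<a
               λ R → VerticalRun.covers-first R (n<1+n j) (opposite-at type λ ())

  -- Leaving P_(c,j) to the east: Q3 joins north to east, the other types west to east.
  leaveBranch : ∀ {c j k} → InInt1 G (gv c j k) →
                Σ[ e ∈ ℕ ] (1 ≤ e × e ≤ a × CoveringColumn c e (λ x vs → Covers (gv c j k) x vs × x ≡ j))
  leaveBranch {c} {j} (c≥2 , c<a , j≥2 , j<a , _) with ptype c j in type
  ... | Q1 = j , ≥2⇒≥1 j≥2 , <⇒≤ j<a , coverUp (c≥2 , c<a) (≥2⇒≥1 j≥2) ≤-refl (<⇒≤ j<a)
               λ R → VerticalRun.covers-single R refl (opposite-at type λ ()) , refl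
  ... | Q2 = j , ≥2⇒≥1 j≥2 , <⇒≤ j<a , coverUp (c≥2 , c<a) (≥2⇒≥1 j≥2) ≤-refl (<⇒≤ j<a)
               λ R → VerticalRun.covers-single R refl (opposite-at type λ ()) , refl
  ... | Q3 = suc j , s≤s z≤n , j<a , coverDown (c≥2 , c<a) (≥2⇒≥1 j≥2) (n≤1+n j) j<a
               λ R → (λ k≤ → Any.reverse⁺ (VerticalRun.covers-first R (n<1+n j) (opposite-at type λ ()) k≤))
                   , refl

  mapCovers : ∀ {c e} {T T′ : ℕ → List Vtx → Set} → (∀ {x vs} → T x vs → T′ x vs) →
              CoveringColumn c e T → CoveringColumn c e T′
  mapCovers f C = record { CoveringColumn C ; covers = f (CoveringColumn.covers C) }

  CoveringPair : ℕ → Vtx → Vtx → Set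
  CoveringPair c τ τ′ =
    Σ[ e ∈ ℕ ] (1 ≤ e × e ≤ a × CoveringColumn c e (λ x vs → Covers τ x vs × Covers τ′ x vs))

  swapPair : ∀ {c} τ τ′ → CoveringPair c τ τ′ → CoveringPair c τ′ τ
  swapPair _ _ (e , e≥1 , e≤a , C) = e , e≥1 , e≤a , mapCovers (λ (cov , cov′) → cov′ , cov) C

  coverFromBelow : ∀ τ → ColumnVertex τ → InInt1 G τ → ∀ {e} → 1 ≤ e → e < highRow τ →
                   CoveringColumn (column τ) e (Covers τ)
  coverFromBelow τ cv I e≥1 e<hi with upTo τ cv I
  ... | x , hi≤x , x≤a , covers =
    coverUp (column-bounds τ I) e≥1 (≤-trans (<⇒≤ e<hi) hi≤x) x≤a (covers e<hi)

  coverFromAbove : ∀ τ → ColumnVertex τ → InInt1 G τ → ∀ {e} → lowRow τ < e → e ≤ a →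
                   CoveringColumn (column τ) e (Covers τ)
  coverFromAbove τ cv I lo<e e≤a with downTo τ cv I
  ... | x , x≥1 , x≤lo , covers =
    coverDown (column-bounds τ I) x≥1 (≤-trans x≤lo (<⇒≤ lo<e)) e≤a (covers lo<e)

  coverOne : ∀ τ → InInt1 G τ → ∀ {e} → 1 ≤ e → e ≤ a → CoveringColumn (column τ) e (Covers τ)
  coverOne (gv c j k) I {e} e≥1 e≤a with <-cmp e j
  ... | tri< e<j _ _  = coverFromBelow (gv c j k) _ I e≥1 e<j
  ... | tri≈ _ refl _ = enterBranch I
  ... | tri> _ _ j<e  = coverFromAbove (gv c j k) _ I j<e e≤a
  coverOne (ve c j k) I {e} e≥1 e≤a with e ≤? j
  ... | yes e≤j = coverFromBelow (ve c j k) _ I e≥1 (s≤s e≤j)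
  ... | no e≰j  = coverFromAbove (ve c j k) _ I (≰⇒> e≰j) e≤a
  coverOne (he c j k) (c≥2 , c+1<a , j≥2 , j<a , _) e≥1 e≤a = record
    { exit = j ; exit≥1 = ≥2⇒≥1 j≥2 ; exit≤a = <⇒≤ j<a
    ; columnPath = anyColumn (≥2⇒≥1 c≥2) (<⇒≤ (<-trans (n<1+n c) c+1<a)) e≥1 e≤a (≥2⇒≥1 j≥2) (<⇒≤ j<a)
    ; covers = refl }

  pairUp : ∀ τ τ′ → ColumnVertex τ → ColumnVertex τ′ → InInt1 G τ → InInt1 G τ′ →
           column τ′ ≡ column τ → lowRow τ < highRow τ′ → CoveringPair (column τ) τ τ′
  pairUp τ τ′ cv cv′ I I′ same lo<hi with upFrom τ cv I | upTo τ′ cv′ I′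
  ... | e , e≥1 , e≤lo , covers | x , hi≤x , x≤a , covers′ =
    e , e≥1 , ≤-trans e≤x x≤a ,
    coverUp (column-bounds τ I) e≥1 e≤x x≤a
      λ R → covers lo<x R , subst (λ c → UpCovers c τ′ e x) same (covers′ e<hi) R
    where
    e<hi = ≤-<-trans e≤lo lo<hi
    lo<x = <-≤-trans lo<hi hi≤x
    e≤x  = <⇒≤ (<-≤-trans e<hi hi≤x)

  exitUpAt : ∀ τ → ColumnVertex τ → InInt1 G τ → ∀ {x k} → lowRow τ < x → x ≤ a →
             CoveringPair (column τ) τ (he (column τ) x k)
  exitUpAt τ cv I lo<x x≤a with upFrom τ cv I
  ... | e , e≥1 , e≤lo , covers =
    e , e≥1 , ≤-trans e≤x x≤a , coverUp (column-bounds τ I) e≥1 e≤x x≤a λ R → covers lo<x R , refl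
    where
    e≤x = <⇒≤ (≤-<-trans e≤lo lo<x)

  exitDownAt : ∀ τ → ColumnVertex τ → InInt1 G τ → ∀ {x k} → 1 ≤ x → x < highRow τ →
               CoveringPair (column τ) τ (he (column τ) x k)
  exitDownAt τ cv I x≥1 x<hi with downFrom τ cv I
  ... | e , hi≤e , e≤a , covers =
    e , ≤-trans x≥1 x≤e , e≤a , coverDown (column-bounds τ I) x≥1 x≤e e≤a λ R → covers x<hi R , refl
    where
    x≤e = <⇒≤ (<-≤-trans x<hi hi≤e)

  coverWithEdge : ∀ τ → ColumnVertex τ → InInt1 G τ → ∀ {x k} → InInt1 G (he (column τ) x k) →
                  CoveringPair (column τ) τ (he (column τ) x k)
  coverWithEdge (gv c j k) _ I {x} {k′} (_ , _ , x≥2 , x<a , _) with <-cmp j x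
  ... | tri< j<x _ _  = exitUpAt (gv c j k) _ I {k = k′} j<x (<⇒≤ x<a)
  ... | tri≈ _ refl _ = leaveBranch I
  ... | tri> _ _ x<j  = exitDownAt (gv c j k) _ I {k = k′} (≥2⇒≥1 x≥2) x<j
  coverWithEdge (ve c j k) _ I {x} {k′} (_ , _ , x≥2 , x<a , _) with j <? x
  ... | yes j<x = exitUpAt (ve c j k) _ I {k = k′} j<x (<⇒≤ x<a)
  ... | no j≮x  = exitDownAt (ve c j k) _ I {k = k′} (≥2⇒≥1 x≥2) (s≤s (≮⇒≥ j≮x))

  coverPair : ∀ τ τ′ → InInt1 G τ → InInt1 G τ′ → column τ′ ≡ column τ → ColumnVertex τ ⊎ ColumnVertex τ′ →
              CoveringPair (column τ) τ τ′
  coverPair τ@(gv c j k) τ′@(gv _ j′ k′) I@(_ , _ , j≥2 , j<a , _) I′ refl _ with <-cmp j j′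
  ... | tri< j<j′ _ _ = pairUp τ τ′ _ _ I I′ refl j<j′
  ... | tri≈ _ refl _ = j , ≥2⇒≥1 j≥2 , <⇒≤ j<a , mapCovers {T = Covers τ} (λ cov → cov , cov) (enterBranch I)
  ... | tri> _ _ j′<j = swapPair τ′ τ (pairUp τ′ τ _ _ I′ I refl j′<j)
  coverPair τ@(gv c j k) τ′@(ve _ j′ k′) I I′ refl _ with j ≤? j′
  ... | yes j≤j′ = pairUp τ τ′ _ _ I I′ refl (s≤s j≤j′)
  ... | no j≰j′  = swapPair τ′ τ (pairUp τ′ τ _ _ I′ I refl (≰⇒> j≰j′))
  coverPair τ@(ve c j k) τ′@(gv _ j′ k′) I I′ refl _ with j′ ≤? j
  ... | yes j′≤j = swapPair τ′ τ (pairUp τ′ τ _ _ I′ I refl (s≤s j′≤j))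
  ... | no j′≰j  = pairUp τ τ′ _ _ I I′ refl (≰⇒> j′≰j)
  coverPair τ@(ve c j k) τ′@(ve _ j′ k′) I I′ refl _ with j ≤? j′
  ... | yes j≤j′ = pairUp τ τ′ _ _ I I′ refl (s≤s j≤j′)
  ... | no j≰j′  = swapPair τ′ τ (pairUp τ′ τ _ _ I′ I refl (m<n⇒m<1+n (≰⇒> j≰j′)))
  coverPair τ@(gv c j k) (he _ x k′) I I′ refl _ = coverWithEdge τ _ I I′
  coverPair τ@(ve c j k) (he _ x k′) I I′ refl _ = coverWithEdge τ _ I I′
  coverPair τ@(he c x k) τ′@(gv _ j′ k′) I I′ refl _ = swapPair τ′ τ (coverWithEdge τ′ _ I′ I)
  coverPair τ@(he c x k) τ′@(ve _ j′ k′) I I′ refl _ = swapPair τ′ τ (coverWithEdge τ′ _ I′ I)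
  coverPair (he c x k) (he _ x′ k′) I I′ refl (inj₁ ())
  coverPair (he c x k) (he _ x′ k′) I I′ refl (inj₂ ())

  covered : ∀ τ {c} → column τ ≡ c → InInt1 G τ → ∀ {x vs} {P : List Vtx} → Covers τ x vs →
            (∀ {v} → v ∈ vs → v ∈ P) → (∀ {k} → k < hsub c x → he c x k ∈ P) → τ ∈ P
  covered (gv c j k) refl (_ , _ , _ , _ , k≤) cov ⊇vs _     = ⊇vs (cov k≤)
  covered (ve c j k) refl (_ , _ , _ , _ , k<) cov ⊇vs _     = ⊇vs (cov k<)
  covered (he c j k) refl (_ , _ , _ , _ , k<) refl _ ⊇edge = ⊇edge k<

  module Assembly (s t : Vtx) (s-in : InColumn G 1 s) (t-in : InColumn G a t) where
    open Routes s

    Goal : Vtx → Vtx → Set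
    Goal v w = Σ (Path G s t) (λ P → v ∈ verts P × w ∈ verts P)

    swapGoal : ∀ {v w} → Goal v w → Goal w v
    swapGoal (P , v∈ , w∈) = P , w∈ , v∈

    viaOneColumn : ∀ τ τ′ → InInt1 G τ → InInt1 G τ′ → column τ′ ≡ column τ →
                   CoveringPair (column τ) τ τ′ → Goal τ τ′
    viaOneColumn τ τ′ I I′ same (e , e≥1 , e≤a , C) =
      fin.path , covered τ refl I (proj₁ C.covers) ⊇column fin.⊇edge ,
                 covered τ′ same I′ (proj₂ C.covers) ⊇column fin.⊇edge
      where
      module C = CoveringColumn C
      c≥2 = proj₁ (column-bounds τ I)
      c<a = proj₂ (column-bounds τ I)
      ext = throughColumn (startPrefix s-in e≥1 e≤a) c≥2 (<⇒≤ c<a) C.columnPath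
      module fin = Completion (complete (toPrefix (≥2⇒≥1 c≥2) C.exit≥1 C.exit≤a ext) c<a t t-in)
      ⊇column : ∀ {v} → v ∈ verts (ColumnPath.path C.columnPath) → v ∈ verts fin.path
      ⊇column v∈ = fin.⊇prefix (Extension.⊇B ext v∈)

    viaTwoColumns : ∀ τ τ′ → InInt1 G τ → InInt1 G τ′ → column τ < column τ′ → Goal τ τ′
    viaTwoColumns τ τ′ I I′ c<c′ =
      fin.path ,
      covered τ refl I C.covers (λ v∈ → fin.⊇prefix (ext′.⊇prefix (ext.⊇B v∈)))
                                (λ k< → fin.⊇prefix (ext′.⊇edge k<)) ,
      covered τ′ refl I′ C′.covers (λ v∈ → fin.⊇prefix (ext′.⊇B v∈)) fin.⊇edge
      where
      c≥2 = proj₁ (column-bounds τ I)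
      c′<a = proj₂ (column-bounds τ′ I′)
      a≥1 = ≤-trans (s≤s z≤n) c′<a
      C = coverOne τ I (s≤s z≤n) a≥1
      module C = CoveringColumn C
      ext = throughColumn (startPrefix s-in (s≤s z≤n) a≥1) c≥2 (<⇒≤ (<-trans c<c′ c′<a)) C.columnPath
      module ext = Extension ext
      C′ = coverOne τ′ I′ C.exit≥1 C.exit≤a
      module C′ = CoveringColumn C′
      ext′ = throughColumn (toPrefix (≥2⇒≥1 c≥2) C.exit≥1 C.exit≤a ext) c<c′ (<⇒≤ c′<a) C′.columnPath
      module ext′ = Extension ext′
      module fin = Completion
        (complete (toPrefix (≤-trans (≥2⇒≥1 c≥2) (<⇒≤ c<c′)) C′.exit≥1 C′.exit≤a ext′) c′<a t t-in)

    viaZigzag : ∀ {c j j′ k k′} → InInt1 G (he c j k) → InInt1 G (he c j′ k′) → j < j′ →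
                Goal (he c j k) (he c j′ k′)
    viaZigzag {c} (c≥2 , c+1<a , j≥2 , _ , k<) (_ , _ , _ , j′<a , k′<) j<j′ =
      fin.path , fin.⊇prefix (ext.⊇B (Z.⊇lower k<)) , fin.⊇prefix (ext.⊇B (Z.⊇upper k′<))
      where
      j≥1 = ≥2⇒≥1 j≥2
      module Z = ZigzagPath (Zigzag.zigzagPath (≥2⇒≥1 c≥2) c+1<a j≥1 j<j′ j′<a)
      ext = extend (startPrefix s-in j≥1 (≤-trans (<⇒≤ j<j′) (<⇒≤ j′<a))) c≥2
              (<⇒≤ (<-trans (n<1+n c) c+1<a)) (n≤1+n c) Z.path Z.within
      module ext = Extension ext
      module fin = Completion (complete (toPrefix (s≤s z≤n) (s≤s z≤n) j′<a ext) c+1<a t t-in)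

    sameColumn : ∀ τ τ′ → InInt1 G τ → InInt1 G τ′ → column τ′ ≡ column τ → Goal τ τ′
    sameColumn τ@(he c j k) τ′@(he _ j′ k′) I I′ refl with <-cmp j j′
    ... | tri< j<j′ _ _ = viaZigzag I I′ j<j′
    ... | tri≈ _ refl _ = viaOneColumn τ τ′ I I′ refl
      (1 , ≤-refl , a≥1 , mapCovers {T = Covers τ} (λ cov → cov , cov) (coverOne τ I ≤-refl a≥1))
      where a≥1 = ≤-trans (s≤s z≤n) (proj₂ (column-bounds τ I))
    ... | tri> _ _ j′<j = swapGoal (viaZigzag I′ I j′<j)
    sameColumn τ@(gv _ _ _) τ′ I I′ same = viaOneColumn τ τ′ I I′ same (coverPair τ τ′ I I′ same (inj₁ _))
    sameColumn τ@(ve _ _ _) τ′ I I′ same = viaOneColumn τ τ′ I I′ same (coverPair τ τ′ I I′ same (inj₁ _))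
    sameColumn τ@(he _ _ _) τ′@(gv _ _ _) I I′ same =
      viaOneColumn τ τ′ I I′ same (coverPair τ τ′ I I′ same (inj₂ _))
    sameColumn τ@(he _ _ _) τ′@(ve _ _ _) I I′ same =
      viaOneColumn τ τ′ I I′ same (coverPair τ τ′ I I′ same (inj₂ _))

    route : ∀ v w → InInt1 G v → InInt1 G w → Goal v w
    route v w Iv Iw with <-cmp (column v) (column w)
    ... | tri< v<w _ _ = viaTwoColumns v w Iv Iw v<w
    ... | tri≈ _ v≡w _ = sameColumn v w Iv Iw (sym v≡w)
    ... | tri> _ _ w<v = swapGoal (viaTwoColumns w v Iw Iv w<v)

lemma10 : (a : ℕ) → 5 ≤ a → (G : Pseudogrid a) → (s v w t : Vtx) →
          InColumn G 1 s → InInt1 G v → InInt1 G w → InColumn G a t →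
          Σ (Path G s t) (λ P → (v ∈ Path.verts P) × (w ∈ Path.verts P))
lemma10 a _ G s v w t s-in v-in w-in t-in = Grid.Assembly.route G s t s-in t-in v w v-in w-in
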